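{- Let $s$ be a state of the standard box-ball system with $n$ balls, with box-label sequence $b=(b_1,\dots,b_n)$, and let $b'=(b'_1,\dots,b'_n)$ be the box-label sequence of the state after one step of time evolution. Put $p=\min_k b_k$, $q=\max_k b_k+n$, and let $C=(l_1<l_2<\dots<l_m)$ be the increasing sequence of labels of the empty boxes of $s$ lying in $[p,q]$. Then the carrier algorithm applied to the word $b$ with initial carrier $C$ outputs exactly $b'$.
   Context: Standard BBS: boxes indexed by $\mathbf{Z}$ with capacity one, $n$ balls of distinct colors $1,\dots,n$, at most one ball per box. One time step: move the ball of color $1$ to the nearest empty box to its right, then the ball of color $2$, and so on up to color $n$, each ball moved exactly once. The box-label sequence of a state is $b=(b_1,\dots,b_n)$ where $b_k$ is the label of the box containing the ball of color $k$. Carrier algorithm: given a weakly increasing sequence (carrier) $C_0=C$ of numbers and a word $w=(w_1,\dots,w_N)$, for $k=1,\dots,N$: if $C_{k-1}$ contains numbers strictly larger than $w_k$, let $w'_k$ be the smallest of them; otherwise let $w'_k=\min C_{k-1}$. Let $C_k$ be obtained from $C_{k-1}$ by replacing one copy of $w'_k$ by $w_k$ (kept sorted). The output word is $(w'_1,\dots,w'_N)$. -}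

module Defs where

open import Data.Nat using (ℕ; zero; suc)
open import Data.Integer using (ℤ; +_; _+_; _-_; _<_; _≤_; _<?_; _≤?_; _≟_; ∣_∣; _⊔_; _⊓_)
open import Data.List using (List; []; _∷_; _++_; length; map; upTo; filter; foldr)
open import Data.List.Membership.DecPropositional _≟_ using (_∈?_)
open import Relation.Nullary using (yes; no; ¬?)

-- A state with n balls is given by its box-label
-- sequence b = (b₁,…,bₙ) : List ℤ  (bₖ = box of the ball of colour k);
-- "at most one ball per box" is the hypothesis that b is duplicate-free.

-- Scans x+1, x+2, … ; the fuel  length occ + 1
-- always suffices, since among the length occ + 1 boxes x+1,…,x+length occ+1
-- at most length occ are occupied.
nextEmptyFuel : ℕ → List ℤ → ℤ → ℤ
nextEmptyFuel zero    occ y = y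
nextEmptyFuel (suc f) occ y with y ∈? occ
... | yes _ = nextEmptyFuel f occ (y + + 1)
... | no  _ = y

nextEmpty : List ℤ → ℤ → ℤ
nextEmpty occ x = nextEmptyFuel (suc (length occ)) occ (x + + 1)

-- moving the balls in colour order: `moved` are the current positions of
-- the balls already moved (colours 1..k-1), the second list the current
-- positions of the balls still to move (colours k..n).
evolveAux : List ℤ → List ℤ → List ℤ
evolveAux moved []       = moved
evolveAux moved (x ∷ xs) = evolveAux (moved ++ (nextEmpty (moved ++ x ∷ xs) x ∷ [])) xs

bbsStep : List ℤ → List ℤ
bbsStep b = evolveAux [] b

minL : List ℤ → ℤ
minL []       = + 0          -- never used for a nonempty state
minL (x ∷ xs) = foldr _⊓_ x xs

maxL : List ℤ → ℤ
maxL []       = + 0          -- never used for a nonempty state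
maxL (x ∷ xs) = foldr _⊔_ x xs

range : ℤ → ℤ → List ℤ
range p q with p ≤? q
... | yes _ = map (λ i → p + + i) (upTo (suc ∣ q - p ∣))
... | no  _ = []

initialCarrier : List ℤ → List ℤ
initialCarrier b = filter (λ z → ¬? (z ∈? b)) (range (minL b) (maxL b + + (length b)))

-- Carrier algorithm.  Carriers are weakly increasing lists of integers.

insert : ℤ → List ℤ → List ℤ
insert w []       = w ∷ []
insert w (y ∷ ys) with w ≤? y
... | yes _ = w ∷ y ∷ ys
... | no  _ = y ∷ insert w ys

removeOne : ℤ → List ℤ → List ℤ
removeOne v []       = []
removeOne v (y ∷ ys) with v ≟ y
... | yes _ = ys
... | no  _ = y ∷ removeOne v ys

firstAbove : ℤ → List ℤ → List ℤ
firstAbove w []       = []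
firstAbove w (y ∷ ys) with w <? y
... | yes _ = y ∷ []
... | no  _ = firstAbove w ys

-- the output letter w' for input letter w and carrier C
-- (for an empty carrier, which never occurs in the proposition, we return w)
outLetter : List ℤ → ℤ → ℤ
outLetter C w with firstAbove w C
... | v ∷ _ = v
... | []    with C
...   | []    = w
...   | y ∷ _ = y      -- min C, since C is sorted

carrier : List ℤ → List ℤ → List ℤ
carrier C []       = []
carrier C (w ∷ ws) = outLetter C w ∷ carrier (insert w (removeOne (outLetter C w) C)) ws

-- Let the balls of colours 1, …, k − 1 have moved already. Then the carrier
-- C_{k−1} is exactly the increasing list of empty boxes in [p, q] of the
-- intermediate state. Ball k sits in box b_k and jumps to the nearest empty
-- box v to its right; the other n − 1 balls cannot fill all of the boxes
-- b_k + 1, …, b_k + n, so v ≤ b_k + n ≤ q and v is the least element of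
-- C_{k−1} above b_k, which is the letter the carrier emits. The move empties
-- b_k and fills v, which is precisely the carrier update replacing v by b_k,
-- so the invariant persists.

{-# OPTIONS --safe #-}
module Submission where

open import Defs
open import Data.Integer using (ℤ)
open import Data.List using (List)
open import Data.List.Relation.Unary.Unique.Propositional using (Unique)
open import Relation.Binary.PropositionalEquality using (_≡_)

open import Level using (Level)
open import Data.Nat.Base as ℕ using (ℕ; zero; suc)
import Data.Nat.Properties as ℕ
open import Data.Integer using (+_; +<+; +≤+; _+_; _-_; _<_; _≤_; _≮_; _≟_; _≤?_; _<?_; ∣_∣; _⊓_; _⊔_)
open import Data.Integer.Properties
open import Data.Integer.Tactic.RingSolver using (solve-∀)
open import Data.List.Base using ([]; _∷_; [_]; _++_; length; map; upTo; filter; foldr)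
open import Data.List.Properties using (length-map; length-upTo; ++-identityʳ; ++-assoc; map-upTo)
open import Data.List.Membership.Propositional using (_∈_; _∉_)
open import Data.List.Membership.Propositional.Properties
  using (∈-map⁺; ∈-map⁻; ∈-upTo⁺; ∈-upTo⁻; ∈-++⁺ʳ; ∈-++⁻; ∈-∃++; ∈-insert; ∈-filter⁺; ∈-filter⁻)
open import Data.List.Membership.DecPropositional _≟_ using (_∈?_)
open import Data.List.Relation.Binary.Subset.Propositional using (_⊆_)
open import Data.List.Relation.Binary.Permutation.Propositional using (↭-sym)
open import Data.List.Relation.Binary.Permutation.Propositional.Properties using (shift; ∈-resp-↭; ↭-length)
open import Data.List.Relation.Unary.Any using (here; there)
open import Data.List.Relation.Unary.All as All using (All; []; _∷_)
open import Data.List.Relation.Unary.AllPairs as AllPairs using (AllPairs; []; _∷_)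
import Data.List.Relation.Unary.AllPairs.Properties as AllPairs
open import Data.List.Relation.Unary.Unique.Propositional.Properties using (Unique[x∷xs]⇒x∉xs)
open import Data.Product.Base using (_×_; _,_; proj₁; proj₂)
open import Data.Sum.Base as Sum using (_⊎_; inj₁; inj₂; [_,_]′)
open import Function.Base using (_∘_)
open import Relation.Nullary using (yes; no; ¬?; contradiction)
open import Relation.Binary.PropositionalEquality using (refl; sym; trans; cong; subst; _≢_; module ≡-Reasoning)

private
  variable
    a : Level
    A : Set a

i+[j-i]≡j : ∀ i j → i + (j - i) ≡ j
i+[j-i]≡j = solve-∀

i+∣j-i∣≡j : ∀ {i j} → i ≤ j → i + + ∣ j - i ∣ ≡ j
i+∣j-i∣≡j {i} {j} i≤j = trans (cong (_+_ i) (0≤i⇒+∣i∣≡i (i≤j⇒0≤j-i i≤j))) (i+[j-i]≡j i j)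

i+[1+n]≡i+n+1 : ∀ i n → i + + suc n ≡ (i + + n) + + 1
i+[1+n]≡i+n+1 i n = trans (cong (_+_ i) (+-comm (+ 1) (+ n))) (sym (+-assoc i (+ n) (+ 1)))

<⇒+1≤ : ∀ {i j} → i < j → i + + 1 ≤ j
<⇒+1≤ {i} i<j = subst (_≤ _) (+-comm (+ 1) i) (i<j⇒suc[i]≤j i<j)

+1≤⇒< : ∀ {i j} → i + + 1 ≤ j → i < j
+1≤⇒< {i} i+1≤j = suc[i]≤j⇒i<j (subst (_≤ _) (+-comm i (+ 1)) i+1≤j)

≤⇒<+1 : ∀ {i j} → i ≤ j → i < j + + 1
≤⇒<+1 i≤j = +1≤⇒< (+-monoˡ-≤ (+ 1) i≤j)

<+1⇒≤ : ∀ {i j} → i < j + + 1 → i ≤ j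
<+1⇒≤ i<j+1 = ≮⇒≥ (λ j<i → <⇒≱ i<j+1 (<⇒+1≤ j<i))

i+m<i+n⇒m<n : ∀ i {m n} → i + + m < i + + n → m ℕ.< n
i+m<i+n⇒m<n i i+m<i+n = ℕ.≰⇒> (λ n≤m → <⇒≱ i+m<i+n (+-monoʳ-≤ i (+≤+ n≤m)))

∈-++-∷⁻ : ∀ {z y : A} xs ys → z ∈ xs ++ y ∷ ys → z ≡ y ⊎ z ∈ xs ++ ys
∈-++-∷⁻ xs ys z∈ with ∈-resp-↭ (shift _ xs ys) z∈
... | here z≡y = inj₁ z≡y
... | there z∈′ = inj₂ z∈′

∈-++-∷⁺ : ∀ {z y : A} xs ys → z ∈ xs ++ ys → z ∈ xs ++ y ∷ ys
∈-++-∷⁺ xs ys z∈ = ∈-resp-↭ (↭-sym (shift _ xs ys)) (there z∈)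

unique-⊆⇒length≤ : ∀ {xs ys : List A} → Unique xs → xs ⊆ ys → length xs ℕ.≤ length ys
unique-⊆⇒length≤ {xs = []}     _              _   = ℕ.z≤n
unique-⊆⇒length≤ {xs = x ∷ xs} (x∉xs ∷ unique) xs⊆ys
  with pre , post , refl ← ∈-∃++ (xs⊆ys (here refl)) =
  ℕ.≤-trans (ℕ.s≤s (unique-⊆⇒length≤ unique xs⊆pre++post))
            (ℕ.≤-reflexive (sym (↭-length (shift x pre post))))
  where
  xs⊆pre++post : xs ⊆ pre ++ post
  xs⊆pre++post z∈xs with ∈-++-∷⁻ pre post (xs⊆ys (there z∈xs))
  ... | inj₁ refl = contradiction refl (All.lookup x∉xs z∈xs)
  ... | inj₂ z∈   = z∈

Increasing : List ℤ → Set
Increasing = AllPairs _<_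

consecutive : ℤ → ℕ → List ℤ
consecutive a k = map (λ i → a + + i) (upTo k)

length-consecutive : ∀ a k → length (consecutive a k) ≡ k
length-consecutive a k = trans (length-map _ (upTo k)) (length-upTo k)

consecutive-increasing : ∀ a k → Increasing (consecutive a k)
consecutive-increasing a k = subst Increasing (sym (map-upTo (λ i → a + + i) k))
  (AllPairs.applyUpTo⁺₁ (λ i → a + + i) k (λ i<j _ → +-monoʳ-< a (+<+ i<j)))

∈-consecutive⁻ : ∀ {z a k} → z ∈ consecutive a k → a ≤ z × z < a + + k
∈-consecutive⁻ {a = a} z∈ with i , i∈ , refl ← ∈-map⁻ (λ i → a + + i) z∈ =
  i≤i+j a (+ i) , +-monoʳ-< a (+<+ (∈-upTo⁻ i∈))

∈-consecutive⁺ : ∀ {z a k} → a ≤ z → z < a + + k → z ∈ consecutive a k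
∈-consecutive⁺ {z} {a} a≤z z<a+k = subst (_∈ _) offset
  (∈-map⁺ (λ i → a + + i) (∈-upTo⁺ (i+m<i+n⇒m<n a (subst (_< _) (sym offset) z<a+k))))
  where
  offset : a + + ∣ z - a ∣ ≡ z
  offset = i+∣j-i∣≡j a≤z

range≡consecutive : ∀ {p q} → p ≤ q → range p q ≡ consecutive p (suc ∣ q - p ∣)
range≡consecutive {p} {q} p≤q with p ≤? q
... | yes _   = refl
... | no p≰q = contradiction p≤q p≰q

end-of-range : ∀ {p q} → p ≤ q → p + + suc ∣ q - p ∣ ≡ q + + 1
end-of-range {p} p≤q = trans (i+[1+n]≡i+n+1 p _) (cong (_+ + 1) (i+∣j-i∣≡j p≤q))

∈-range⁻ : ∀ {z p q} → p ≤ q → z ∈ range p q → p ≤ z × z ≤ q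
∈-range⁻ {z} p≤q z∈
  with p≤z , z<end ← ∈-consecutive⁻ (subst (z ∈_) (range≡consecutive p≤q) z∈) =
  p≤z , <+1⇒≤ (subst (z <_) (end-of-range p≤q) z<end)

∈-range⁺ : ∀ {z p q} → p ≤ z → z ≤ q → z ∈ range p q
∈-range⁺ {z} p≤z z≤q = subst (z ∈_) (sym (range≡consecutive p≤q))
  (∈-consecutive⁺ p≤z (subst (z <_) (sym (end-of-range p≤q)) (≤⇒<+1 z≤q)))
  where p≤q = ≤-trans p≤z z≤q

-- The nearest empty box

Occupied : List ℤ → ℤ → ℤ → Set
Occupied occ a v = ∀ {z} → a ≤ z → z < v → z ∈ occ

occupied-refl : ∀ {occ a} → Occupied occ a a
occupied-refl a≤z z<a = contradiction (≤-<-trans a≤z z<a) (<-irrefl refl)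

occupied-extendˡ : ∀ {occ a v} → a ∈ occ → Occupied occ (a + + 1) v → Occupied occ a v
occupied-extendˡ {a = a} a∈ occupied {z} a≤z z<v with a ≟ z
... | yes refl = a∈
... | no a≢z   = occupied (<⇒+1≤ (≤∧≢⇒< a≤z a≢z)) z<v

occupied⇒≤+length : ∀ {occ a v} → Occupied occ a v → v ≤ a + + length occ
occupied⇒≤+length {occ} {a} {v} occupied = ≮⇒≥ too-many-balls
  where
  too-many-balls : a + + length occ ≮ v
  too-many-balls a+L<v = ℕ.1+n≰n (subst (ℕ._≤ length occ) (length-consecutive a _)
    (unique-⊆⇒length≤ (AllPairs.map <⇒≢ (consecutive-increasing a _)) block⊆occ))
    where
    block⊆occ : consecutive a (suc (length occ)) ⊆ occ
    block⊆occ z∈ with a≤z , z<end ← ∈-consecutive⁻ z∈ =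
      occupied a≤z (<-≤-trans z<end (subst (_≤ v) (sym (i+[1+n]≡i+n+1 a _)) (<⇒+1≤ a+L<v)))

nextEmptyFuel-spec : ∀ f occ y → let v = nextEmptyFuel f occ y in
                     y ≤ v × Occupied occ y v × (v ∉ occ ⊎ v ≡ y + + f)
nextEmptyFuel-spec zero    occ y = ≤-refl , occupied-refl , inj₂ (sym (+-identityʳ y))
nextEmptyFuel-spec (suc f) occ y with y ∈? occ
... | no y∉ = ≤-refl , occupied-refl , inj₁ y∉
... | yes y∈ with y+1≤v , occupied , found ← nextEmptyFuel-spec f occ (y + + 1) =
  <⇒≤ (+1≤⇒< y+1≤v) , occupied-extendˡ y∈ occupied ,
  Sum.map₂ (λ v≡ → trans v≡ (+-assoc y (+ 1) (+ f))) found

record NearestEmpty (occ : List ℤ) (x v : ℤ) : Set where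
  field
    beyond : x < v
    vacant : v ∉ occ
    filled : Occupied occ x v
    near   : v ≤ x + + length occ

nextEmpty-spec : ∀ {occ x} → x ∈ occ → NearestEmpty occ x (nextEmpty occ x)
nextEmpty-spec {occ} {x} x∈
  with x+1≤v , occupied , found ← nextEmptyFuel-spec (suc (length occ)) occ (x + + 1) = record
    { beyond = +1≤⇒< x+1≤v
    ; vacant = Sum.fromInj₁ (contradiction v≤x+L ∘ <⇒≱ ∘ too-far) found
    ; filled = occupied′
    ; near   = v≤x+L
    }
  where
  L = length occ
  v = nextEmpty occ x
  occupied′ : Occupied occ x v
  occupied′ = occupied-extendˡ x∈ occupied
  v≤x+L : v ≤ x + + L
  v≤x+L = occupied⇒≤+length occupied′
  too-far : v ≡ (x + + 1) + + suc L → x + + L < v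
  too-far v≡ = subst (x + + L <_) (sym (trans v≡ (+-assoc x (+ 1) (+ suc L))))
    (+-monoʳ-< x (+<+ (ℕ.m<n⇒m<1+n (ℕ.n<1+n L))))

-- The carrier algorithm

∈-insert⁻ : ∀ {z} x C → z ∈ insert x C → z ≡ x ⊎ z ∈ C
∈-insert⁻ x []       (here z≡x) = inj₁ z≡x
∈-insert⁻ x (y ∷ ys) z∈ with x ≤? y | z∈
... | yes _ | here z≡x  = inj₁ z≡x
... | yes _ | there z∈C = inj₂ z∈C
... | no _  | here z≡y  = inj₂ (here z≡y)
... | no _  | there z∈′ = Sum.map₂ there (∈-insert⁻ x ys z∈′)

∈-insert⁺ˡ : ∀ x C → x ∈ insert x C
∈-insert⁺ˡ x []       = here refl
∈-insert⁺ˡ x (y ∷ ys) with x ≤? y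
... | yes _ = here refl
... | no _  = there (∈-insert⁺ˡ x ys)

∈-insert⁺ʳ : ∀ {z} x C → z ∈ C → z ∈ insert x C
∈-insert⁺ʳ x (y ∷ ys) z∈ with x ≤? y | z∈
... | yes _ | _         = there z∈
... | no _  | here z≡y  = here z≡y
... | no _  | there z∈′ = there (∈-insert⁺ʳ x ys z∈′)

All-insert : ∀ {P : ℤ → Set} x C → P x → All P C → All P (insert x C)
All-insert x []       px []         = px ∷ []
All-insert x (y ∷ ys) px (py ∷ pys) with x ≤? y
... | yes _ = px ∷ py ∷ pys
... | no _  = py ∷ All-insert x ys px pys

insert-increasing : ∀ x C → Increasing C → x ∉ C → Increasing (insert x C)
insert-increasing x []       []         _   = [] ∷ []
insert-increasing x (y ∷ ys) (y< ∷ inc) x∉ with x ≤? y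
... | yes x≤y = (x<y ∷ All.map (<-trans x<y) y<) ∷ y< ∷ inc
  where x<y = ≤∧≢⇒< x≤y (x∉ ∘ here)
... | no x≰y  = All-insert x ys (≰⇒> x≰y) y< ∷ insert-increasing x ys inc (x∉ ∘ there)

∈-removeOne⁻ : ∀ {z} v C → z ∈ removeOne v C → z ∈ C
∈-removeOne⁻ v (y ∷ ys) z∈ with v ≟ y | z∈
... | yes _ | z∈ys      = there z∈ys
... | no _  | here z≡y  = here z≡y
... | no _  | there z∈′ = there (∈-removeOne⁻ v ys z∈′)

∈-removeOne⁺ : ∀ {z} v C → z ∈ C → z ≢ v → z ∈ removeOne v C
∈-removeOne⁺ v (y ∷ ys) z∈ z≢v with v ≟ y | z∈
... | yes refl | here z≡v  = contradiction z≡v z≢v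
... | yes _    | there z∈′ = z∈′
... | no _     | here z≡y  = here z≡y
... | no _     | there z∈′ = there (∈-removeOne⁺ v ys z∈′ z≢v)

removeOne-∉ : ∀ v C → Unique C → v ∉ removeOne v C
removeOne-∉ v (y ∷ ys) (y≢ ∷ unique) v∈ with v ≟ y | v∈
... | yes refl | v∈ys      = All.lookup y≢ v∈ys refl
... | no v≢y   | here v≡y  = v≢y v≡y
... | no _     | there v∈′ = removeOne-∉ v ys unique v∈′

All-removeOne : ∀ {P : ℤ → Set} v C → All P C → All P (removeOne v C)
All-removeOne v []       []         = []
All-removeOne v (y ∷ ys) (py ∷ pys) with v ≟ y
... | yes _ = pys
... | no _  = py ∷ All-removeOne v ys pys

AllPairs-removeOne : ∀ {R : ℤ → ℤ → Set} v C → AllPairs R C → AllPairs R (removeOne v C)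
AllPairs-removeOne v []       []         = []
AllPairs-removeOne v (y ∷ ys) (ry ∷ rys) with v ≟ y
... | yes _ = rys
... | no _  = All-removeOne v ys ry ∷ AllPairs-removeOne v ys rys

firstAbove-least : ∀ {w v} C → Increasing C → v ∈ C → w < v →
                   (∀ {u} → u ∈ C → w < u → v ≤ u) → firstAbove w C ≡ [ v ]
firstAbove-least {w} {v} (y ∷ ys) (y< ∷ inc) v∈ w<v least with w <? y | v∈
... | yes w<y | here v≡y = cong [_] (sym v≡y)
... | yes w<y | there v∈ys = contradiction (least (here refl) w<y) (<⇒≱ (All.lookup y< v∈ys))
... | no w≮y  | here refl = contradiction w<v w≮y
... | no _    | there v∈ys = firstAbove-least ys inc v∈ys w<v (least ∘ there)

outLetter-least : ∀ {w v} C → Increasing C → v ∈ C → w < v →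
                  (∀ {u} → u ∈ C → w < u → v ≤ u) → outLetter C w ≡ v
outLetter-least C inc v∈ w<v least rewrite firstAbove-least C inc v∈ w<v least = refl

record EmptyBoxes (p q : ℤ) (occ C : List ℤ) : Set where
  field
    increasing : Increasing C
    sound      : ∀ {z} → z ∈ C → p ≤ z × z ≤ q × z ∉ occ
    complete   : ∀ {z} → p ≤ z → z ≤ q → z ∉ occ → z ∈ C

emptyBoxes-filter-range : ∀ {p q} occ → p ≤ q →
                          EmptyBoxes p q occ (filter (λ z → ¬? (z ∈? occ)) (range p q))
emptyBoxes-filter-range {p} {q} occ p≤q = record
  { increasing = AllPairs.filter⁺ empty?
                   (subst Increasing (sym (range≡consecutive p≤q)) (consecutive-increasing p _))
  ; sound      = sound
  ; complete   = λ p≤z z≤q z∉ → ∈-filter⁺ empty? (∈-range⁺ p≤z z≤q) z∉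
  }
  where
  empty? = λ z → ¬? (z ∈? occ)
  sound : ∀ {z} → z ∈ filter empty? (range p q) → p ≤ z × z ≤ q × z ∉ occ
  sound z∈ with z∈range , z∉ ← ∈-filter⁻ empty? z∈ with p≤z , z≤q ← ∈-range⁻ p≤q z∈range =
    p≤z , z≤q , z∉

emptyBoxes-relocate : ∀ {p q x v} xs ys {C} → EmptyBoxes p q (xs ++ x ∷ ys) C →
                      p ≤ x → x ≤ q → x ∉ xs ++ ys → x ≢ v →
                      EmptyBoxes p q (xs ++ v ∷ ys) (insert x (removeOne v C))
emptyBoxes-relocate {p} {q} {x} {v} xs ys {C} boxes p≤x x≤q x∉ x≢v = record
  { increasing = insert-increasing x (removeOne v C) (AllPairs-removeOne v C increasing)
                   (x∉C ∘ ∈-removeOne⁻ v C)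
  ; sound      = sound′
  ; complete   = complete′
  }
  where
  open EmptyBoxes boxes
  x∉C : x ∉ C
  x∉C x∈C = proj₂ (proj₂ (sound x∈C)) (∈-insert xs)
  sound′ : ∀ {z} → z ∈ insert x (removeOne v C) → p ≤ z × z ≤ q × z ∉ xs ++ v ∷ ys
  sound′ z∈ with ∈-insert⁻ x _ z∈
  ... | inj₁ refl = p≤x , x≤q , [ x≢v , x∉ ]′ ∘ ∈-++-∷⁻ xs ys
  ... | inj₂ z∈C∖v with p≤z , z≤q , z∉ ← sound (∈-removeOne⁻ v C z∈C∖v) =
    p≤z , z≤q , [ z≢v , z∉ ∘ ∈-++-∷⁺ xs ys ]′ ∘ ∈-++-∷⁻ xs ys
    where
    z≢v = λ z≡v → removeOne-∉ v C (AllPairs.map <⇒≢ increasing) (subst (_∈ _) z≡v z∈C∖v)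
  complete′ : ∀ {z} → p ≤ z → z ≤ q → z ∉ xs ++ v ∷ ys → z ∈ insert x (removeOne v C)
  complete′ {z} p≤z z≤q z∉ with z ≟ x
  ... | yes refl = ∈-insert⁺ˡ x (removeOne v C)
  ... | no z≢x   = ∈-insert⁺ʳ x _ (∈-removeOne⁺ v C (complete p≤z z≤q z∉occ) z≢v)
    where
    z≢v : z ≢ v
    z≢v refl = z∉ (∈-insert xs)
    z∉occ : z ∉ xs ++ x ∷ ys
    z∉occ = [ z≢x , z∉ ∘ ∈-++-∷⁺ xs ys ]′ ∘ ∈-++-∷⁻ xs ys

foldr-⊓-≤ : ∀ y ys {x} → x ∈ y ∷ ys → foldr _⊓_ y ys ≤ x
foldr-⊓-≤ y []       (here refl)         = ≤-refl
foldr-⊓-≤ y (z ∷ zs) (there (here refl)) = i⊓j≤i z _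
foldr-⊓-≤ y (z ∷ zs) (here refl)         = ≤-trans (i⊓j≤j z _) (foldr-⊓-≤ y zs (here refl))
foldr-⊓-≤ y (z ∷ zs) (there (there x∈))  = ≤-trans (i⊓j≤j z _) (foldr-⊓-≤ y zs (there x∈))

≤-foldr-⊔ : ∀ y ys {x} → x ∈ y ∷ ys → x ≤ foldr _⊔_ y ys
≤-foldr-⊔ y []       (here refl)         = ≤-refl
≤-foldr-⊔ y (z ∷ zs) (there (here refl)) = i≤i⊔j z _
≤-foldr-⊔ y (z ∷ zs) (here refl)         = ≤-trans (≤-foldr-⊔ y zs (here refl)) (i≤j⊔i z _)
≤-foldr-⊔ y (z ∷ zs) (there (there x∈))  = ≤-trans (≤-foldr-⊔ y zs (there x∈)) (i≤j⊔i z _)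

minL≤ : ∀ b {x} → x ∈ b → minL b ≤ x
minL≤ (y ∷ ys) = foldr-⊓-≤ y ys

≤maxL : ∀ b {x} → x ∈ b → x ≤ maxL b
≤maxL (y ∷ ys) = ≤-foldr-⊔ y ys

-- One time step

module Evolution (p M : ℤ) (N : ℕ) where

  q : ℤ
  q = M + + N

  record Invariant (moved pending C : List ℤ) : Set where
    field
      unique     : Unique pending
      fresh      : All (_∉ moved) pending
      size       : length (moved ++ pending) ≡ N
      bounded    : All (λ y → p ≤ y × y ≤ M) pending
      emptyBoxes : EmptyBoxes p q (moved ++ pending) C

  module Step {moved x xs C} (inv : Invariant moved (x ∷ xs) C) where
    open Invariant inv
    open EmptyBoxes emptyBoxes

    v : ℤ
    v = nextEmpty (moved ++ x ∷ xs) x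

    open NearestEmpty (nextEmpty-spec {moved ++ x ∷ xs} (∈-insert moved))

    p≤x : p ≤ x
    p≤x = proj₁ (All.head bounded)

    x≤M : x ≤ M
    x≤M = proj₂ (All.head bounded)

    v≤q : v ≤ q
    v≤q = ≤-trans (subst (λ n → v ≤ x + + n) size near) (+-monoˡ-≤ (+ N) x≤M)

    outLetter≡v : outLetter C x ≡ v
    outLetter≡v = outLetter-least C increasing v∈C beyond least
      where
      v∈C : v ∈ C
      v∈C = complete (≤-trans p≤x (<⇒≤ beyond)) v≤q vacant
      least : ∀ {u} → u ∈ C → x < u → v ≤ u
      least u∈C x<u = ≮⇒≥ (λ u<v → proj₂ (proj₂ (sound u∈C)) (filled (<⇒≤ x<u) u<v))

    invariant′ : Invariant (moved ++ [ v ]) xs (insert x (removeOne v C))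
    invariant′ = record
      { unique     = AllPairs.tail unique
      ; fresh      = All.tabulate not-moved
      ; size       = size′
      ; bounded    = All.tail bounded
      ; emptyBoxes = subst (λ occ → EmptyBoxes p q occ (insert x (removeOne v C)))
                       (sym (++-assoc moved [ v ] xs))
                       (emptyBoxes-relocate moved xs emptyBoxes p≤x (≤-trans x≤M (i≤i+j M (+ N)))
                                            x∉ (<⇒≢ beyond))
      }
      where
      not-moved : ∀ {y} → y ∈ xs → y ∉ moved ++ [ v ]
      not-moved y∈xs y∈ with ∈-++⁻ moved y∈
      ... | inj₁ y∈moved     = All.lookup (All.tail fresh) y∈xs y∈moved
      ... | inj₂ (here refl) = vacant (∈-++⁺ʳ moved (there y∈xs))
      size′ : length ((moved ++ [ v ]) ++ xs) ≡ N
      size′ = begin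
        length ((moved ++ [ v ]) ++ xs) ≡⟨ cong length (++-assoc moved [ v ] xs) ⟩
        length (moved ++ v ∷ xs)        ≡⟨ ↭-length (shift v moved xs) ⟩
        suc (length (moved ++ xs))      ≡⟨ ↭-length (shift x moved xs) ⟨
        length (moved ++ x ∷ xs)        ≡⟨ size ⟩
        N                               ∎
        where open ≡-Reasoning
      x∉ : x ∉ moved ++ xs
      x∉ = [ All.head fresh , Unique[x∷xs]⇒x∉xs unique ]′ ∘ ∈-++⁻ moved

  carrier-evolveAux : ∀ moved pending C → Invariant moved pending C →
                      moved ++ carrier C pending ≡ evolveAux moved pending
  carrier-evolveAux moved []       C _   = ++-identityʳ moved
  carrier-evolveAux moved (x ∷ xs) C inv = begin
    moved ++ carrier C (x ∷ xs)
      ≡⟨ cong (λ w → moved ++ w ∷ carrier (insert x (removeOne w C)) xs) outLetter≡v ⟩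
    moved ++ v ∷ carrier C′ xs         ≡⟨ ++-assoc moved [ v ] _ ⟨
    (moved ++ [ v ]) ++ carrier C′ xs  ≡⟨ carrier-evolveAux (moved ++ [ v ]) xs C′ invariant′ ⟩
    evolveAux (moved ++ [ v ]) xs      ∎
    where
    open ≡-Reasoning
    open Step inv
    C′ = insert x (removeOne v C)

open Evolution using (Invariant; carrier-evolveAux)

proposition3p3 : (b : List ℤ) → Unique b →
    carrier (initialCarrier b) b ≡ bbsStep b
proposition3p3 []          _      = refl
proposition3p3 b@(_ ∷ _)   unique = carrier-evolveAux p M N [] b (initialCarrier b) initial
  where
  p = minL b
  M = maxL b
  N = length b
  initial : Invariant p M N [] b (initialCarrier b)
  initial = record
    { unique     = unique
    ; fresh      = All.tabulate (λ _ ())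
    ; size       = refl
    ; bounded    = All.tabulate (λ y∈b → minL≤ b y∈b , ≤maxL b y∈b)
    ; emptyBoxes = emptyBoxes-filter-range b
                     (≤-trans (minL≤ b (here refl)) (≤-trans (≤maxL b (here refl)) (i≤i+j M (+ N))))
    }
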